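{- Let $k\geq 2$ and $n\geq 3$ be integers. Then the following two statements are equivalent: (a) every $k$-strong digraph of order $n$ which has $n-1$ vertices of degree at least $n$ is Hamiltonian; (b) every $(k+1)$-strong digraph of order $n+1$ with minimum degree at least $n+2$ is strongly Hamiltonian-connected.
   Context: All digraphs are finite, without loops and without multiple arcs (opposite arcs $xy$ and $yx$ may both be present). For a vertex $x$, $d(x)=d^+(x)+d^-(x)$. A digraph $D$ is $k$-strong if $|V(D)|\geq k+1$ and $D-A$ is strongly connected for every set $A$ of at most $k-1$ vertices. A digraph is Hamiltonian if it contains a directed cycle through all its vertices. A digraph is strongly Hamiltonian-connected if for every ordered pair of distinct vertices $x,y$ there is a directed path from $x$ to $y$ containing all vertices. -}

module Defs where

open import Data.Nat using (ℕ; zero; suc; _+_; _∸_; _≤_)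
open import Data.Bool using (Bool; true; false; if_then_else_)
open import Data.Fin using (Fin; zero; suc)
open import Data.Fin.Subset using (Subset; ∣_∣) renaming (_∈_ to _∈ₛ_; _∉_ to _∉ₛ_)
open import Data.List using (List; []; _∷_)
open import Data.List.Relation.Unary.All using (All)
open import Data.List.Relation.Unary.Unique.Propositional using (Unique)
open import Data.List.Membership.Propositional using (_∈_)
open import Data.Product using (Σ; ∃; _×_)
open import Relation.Binary.PropositionalEquality using (_≡_; _≢_)

count : ∀ {n} → (Fin n → Bool) → ℕ
count {zero}  p = 0
count {suc n} p = (if p zero then 1 else 0) + count (λ i → p (suc i))

-- A digraph on vertex set Fin n: adjacency relation, no loops
-- (no multiple arcs automatically; opposite arcs allowed).
record Digraph (n : ℕ) : Set where
  field
    adj      : Fin n → Fin n → Bool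
    loopless : ∀ x → adj x x ≡ false

module _ {n : ℕ} (D : Digraph n) where
  open Digraph D

  Arc : Fin n → Fin n → Set
  Arc x y = adj x y ≡ true

  outdeg indeg deg : Fin n → ℕ
  outdeg x = count (λ y → adj x y)
  indeg  x = count (λ y → adj y x)
  deg    x = outdeg x + indeg x

  data Path : Fin n → Fin n → List (Fin n) → Set where
    single : ∀ x → Path x x (x ∷ [])
    step   : ∀ {x y z vs} → Arc x y → Path y z vs → Path x z (x ∷ vs)

  StronglyConnectedMinus : Subset n → Set
  StronglyConnectedMinus A =
    ∀ x y → x ∉ₛ A → y ∉ₛ A →
      ∃ λ vs → Path x y vs × All (λ v → v ∉ₛ A) vs

  KStrong : ℕ → Set
  KStrong k = (k + 1 ≤ n) × (∀ (A : Subset n) → ∣ A ∣ ≤ k ∸ 1 → StronglyConnectedMinus A)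

  HamPath : Fin n → Fin n → Set
  HamPath x y = ∃ λ vs → Path x y vs × Unique vs × (∀ v → v ∈ vs)

  Hamiltonian : Set
  Hamiltonian = ∃ λ x → ∃ λ y → HamPath x y × Arc y x

  StronglyHamiltonianConnected : Set
  StronglyHamiltonianConnected = ∀ x y → x ≢ y → HamPath x y

StatementA : ℕ → ℕ → Set
StatementA k n = ∀ (D : Digraph n) → KStrong D k →
  (∃ λ (S : Subset n) → ∣ S ∣ ≡ n ∸ 1 × (∀ x → x ∈ₛ S → n ≤ deg D x)) →
  Hamiltonian D

StatementB : ℕ → ℕ → Set
StatementB k n = ∀ (D : Digraph (n + 1)) → KStrong D (k + 1) →
  (∀ x → n + 2 ≤ deg D x) →
  StronglyHamiltonianConnected D

module Submission where

-- Both implications are reductions through a local modification.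
-- (b) ⇒ (a): split the one vertex w of possibly small degree into a copy
--   keeping its out-arcs and a new vertex taking its in-arcs, both joined
--   to everything; this digraph satisfies the hypotheses of (b), and a
--   Hamiltonian path from the first copy to the second closes up into a
--   Hamiltonian cycle of the original digraph.
-- (a) ⇒ (b): to find a Hamiltonian path from x to y, delete y and let x
--   take over the in-arcs of y; this digraph satisfies the hypotheses of
--   (a), and a Hamiltonian cycle started at x unfolds into the path.

open import Defs
open import Data.Bool using (Bool; true; false; if_then_else_; not; _∨_; _∧_)
open import Data.Empty using (⊥; ⊥-elim)
open import Data.Fin using (Fin; zero; suc; punchIn; punchOut)
open import Data.Fin.Properties using (_≟_; ¬∀⟶∃¬; punchIn-punchOut; punchInᵢ≢i; punchIn-injective)
  renaming (suc-injective to Fin-suc-injective)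
open import Data.Fin.Subset using (Subset; ∣_∣; ⊤; ⁅_⁆; ∁) renaming (_∈_ to _∈ₛ_; _∉_ to _∉ₛ_; ⊥ to ∅)
open import Data.Fin.Subset.Properties
  using (_∈?_; ∈⊤; p⊆q⇒∣p∣≤∣q∣; ∣p∣≡n⇒p≡⊤; ∣⊤∣≡n; x∈⁅x⁆; x∈∁p⇒x∉p; ∣∁p∣≡n∸∣p∣;
         ∣⁅x⁆∣≡1) renaming (∉⊥ to ∉∅; ∣⊥∣≡0 to ∣∅∣≡0)
open import Data.List using (List; []; _∷_; _++_; map)
open import Data.List.Membership.Propositional using (_∈_; _∉_)
open import Data.List.Membership.Propositional.Properties using (∈-∃++; ∈-++⁻; ∈-++⁺ˡ; ∈-++⁺ʳ; ∈-map⁺; ∈-map⁻)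
open import Data.List.Relation.Binary.Permutation.Propositional using (_↭_; ↭-trans; ↭-prep; ↭⇒↭ₛ)
open import Data.List.Relation.Binary.Permutation.Propositional.Properties using (shift; ++-comm; ∈-resp-↭)
import Data.List.Relation.Binary.Permutation.Setoid.Properties as Permutationₛ
open import Data.List.Relation.Unary.All using (All; []; _∷_)
import Data.List.Relation.Unary.All as All
import Data.List.Relation.Unary.All.Properties as Allₚ
open import Data.List.Relation.Unary.AllPairs using ([]; _∷_)
open import Data.List.Relation.Unary.Any using (here; there; any?)
open import Data.List.Relation.Unary.Unique.Propositional using (Unique)
import Data.List.Relation.Unary.Unique.Propositional.Properties as Uniqueₚ
open import Data.Nat using (ℕ; zero; suc; _+_; _∸_; _≤_; z≤n; s≤s)
open import Data.Nat.Properties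
  using (+-identityʳ; +-assoc; +-comm; +-mono-≤; +-monoˡ-≤; +-monoʳ-≤; +-cancelʳ-≤; ∸-monoˡ-≤;
         m≤n+m; m+n∸n≡m; m∸n+n≡m; 1+n≰n; ≤-trans; ≤-pred; module ≤-Reasoning)
open import Data.Nat.Tactic.RingSolver using (solve-∀)
open import Data.Product using (∃; _×_; _,_; proj₁; proj₂)
open import Data.Sum using (inj₁; inj₂)
open import Data.Vec using ([]; _∷_; lookup; _[_]≔_; insertAt; here; there)
open import Data.Vec.Properties
  using ([]=⇒lookup; lookup⇒[]=; []=-injective; []≔-updates; []≔-minimal; lookup∘update; lookup∘update′;
         insertAt-lookup; insertAt-punchIn)
open import Function.Base using (_∘_)
open import Function.Bundles using (_⇔_; mk⇔)
open import Relation.Nullary using (¬_; Dec; yes; no; does; contradiction)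
open import Relation.Nullary.Decidable using (dec-true; dec-false)
open import Relation.Binary.PropositionalEquality

bit : Bool → ℕ
bit b = if b then 1 else 0

bit≤1 : ∀ b → bit b ≤ 1
bit≤1 true  = s≤s z≤n
bit≤1 false = z≤n

count-cong : ∀ {n} {f g : Fin n → Bool} → (∀ i → f i ≡ g i) → count f ≡ count g
count-cong {zero}  f≗g = refl
count-cong {suc n} f≗g = cong₂ (λ b c → bit b + c) (f≗g zero) (count-cong (λ i → f≗g (suc i)))

count-update : ∀ {n} (f g : Fin n → Bool) (p : Fin n) → (∀ i → i ≢ p → f i ≡ g i) →
  count f + bit (g p) ≡ count g + bit (f p)
count-update {suc n} f g zero f≗g
  rewrite count-cong {f = λ i → f (suc i)} {g = λ i → g (suc i)} (λ i → f≗g (suc i) (λ ()))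
  = swap (bit (f zero)) _ (bit (g zero))
  where
  swap : ∀ a c b → a + c + b ≡ b + c + a
  swap = solve-∀
count-update {suc n} f g (suc p) f≗g rewrite f≗g zero (λ ()) = begin
  bit (g zero) + count (λ i → f (suc i)) + bit (g (suc p))   ≡⟨ +-assoc (bit (g zero)) _ _ ⟩
  bit (g zero) + (count (λ i → f (suc i)) + bit (g (suc p)))
    ≡⟨ cong (bit (g zero) +_) (count-update _ _ p (λ i i≢p → f≗g (suc i) (i≢p ∘ Fin-suc-injective))) ⟩
  bit (g zero) + (count (λ i → g (suc i)) + bit (f (suc p))) ≡⟨ +-assoc (bit (g zero)) _ _ ⟨
  bit (g zero) + count (λ i → g (suc i)) + bit (f (suc p))   ∎
  where open ≡-Reasoning

count-punchIn : ∀ {n} (i : Fin (suc n)) (f : Fin (suc n) → Bool) →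
  count (λ j → f (punchIn i j)) + bit (f i) ≡ count f
count-punchIn zero    f = +-comm _ (bit (f zero))
count-punchIn {suc n} (suc i) f =
  trans (+-assoc (bit (f zero)) _ _) (cong (bit (f zero) +_) (count-punchIn i (λ j → f (suc j))))

count-pos : ∀ {n} (f : Fin n → Bool) (i : Fin n) → f i ≡ true → 1 ≤ count f
count-pos f zero    fi rewrite fi = s≤s z≤n
count-pos f (suc i) fi = ≤-trans (count-pos (λ j → f (suc j)) i fi) (m≤n+m _ (bit (f zero)))

count-all : ∀ n → count {n} (λ _ → true) ≡ n
count-all zero    = refl
count-all (suc n) = cong suc (count-all n)

∣∣≡count : ∀ {n} (A : Subset n) → ∣ A ∣ ≡ count (lookup A)
∣∣≡count []          = refl
∣∣≡count (true  ∷ A) = cong suc (∣∣≡count A)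
∣∣≡count (false ∷ A) = ∣∣≡count A

∣insertAt∣ : ∀ {n} (B : Subset n) (i : Fin (suc n)) b → ∣ insertAt B i b ∣ ≡ ∣ B ∣ + bit b
∣insertAt∣ B i b = begin
  ∣ insertAt B i b ∣                                                ≡⟨ ∣∣≡count (insertAt B i b) ⟩
  count (lookup (insertAt B i b))                                   ≡⟨ count-punchIn i (lookup (insertAt B i b)) ⟨
  count (λ j → lookup (insertAt B i b) (punchIn i j)) + bit (lookup (insertAt B i b) i)
    ≡⟨ cong₂ (λ c d → c + bit d) (count-cong (insertAt-punchIn B i b)) (insertAt-lookup B i b) ⟩
  count (lookup B) + bit b                                          ≡⟨ cong (_+ bit b) (∣∣≡count B) ⟨
  ∣ B ∣ + bit b                                                     ∎
  where open ≡-Reasoning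

∣update∣ : ∀ {n} (B : Subset n) (i : Fin n) b → ∣ B [ i ]≔ b ∣ + bit (lookup B i) ≡ ∣ B ∣ + bit b
∣update∣ B i b = begin
  ∣ B [ i ]≔ b ∣ + bit (lookup B i)                 ≡⟨ cong (_+ bit (lookup B i)) (∣∣≡count (B [ i ]≔ b)) ⟩
  count (lookup (B [ i ]≔ b)) + bit (lookup B i)    ≡⟨ count-update _ _ i (λ j j≢i → lookup∘update′ j≢i B b) ⟩
  count (lookup B) + bit (lookup (B [ i ]≔ b) i)
    ≡⟨ cong₂ (λ c d → c + bit d) (sym (∣∣≡count B)) (lookup∘update i B b) ⟩
  ∣ B ∣ + bit b                                     ∎
  where open ≡-Reasoning

∈⇒lookup : ∀ {n} {A : Subset n} {x} → x ∈ₛ A → lookup A x ≡ true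
∈⇒lookup = []=⇒lookup

∉⇒lookup : ∀ {n} {A : Subset n} {x} → x ∉ₛ A → lookup A x ≡ false
∉⇒lookup {A = A} {x} x∉A with lookup A x in eq
... | true  = contradiction (lookup⇒[]= x A eq) x∉A
... | false = refl

lookup⇒∉ : ∀ {n} {A : Subset n} {x} → lookup A x ≡ false → x ∉ₛ A
lookup⇒∉ Ax≡false x∈A with trans (sym (∈⇒lookup x∈A)) Ax≡false
... | ()

∉-updated : ∀ {n} (A : Subset n) w → w ∉ₛ A [ w ]≔ false
∉-updated A w w∈A′ with []=-injective w∈A′ ([]≔-updates A w)
... | ()

∈-update⁻ : ∀ {n} {A : Subset n} {v w b} → v ≢ w → v ∈ₛ A [ w ]≔ b → v ∈ₛ A
∈-update⁻ {A = A} v≢w v∈A′ = lookup⇒[]= _ A (trans (sym (lookup∘update′ v≢w A _)) ([]=⇒lookup v∈A′))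

∈-insertAt⁺ : ∀ {n} {B : Subset n} {i b c} → c ∈ₛ B → punchIn i c ∈ₛ insertAt B i b
∈-insertAt⁺ {B = B} {i} {b} {c} c∈B =
  lookup⇒[]= _ (insertAt B i b) (trans (insertAt-punchIn B i b c) ([]=⇒lookup c∈B))

∈-insertAt⁻ : ∀ {n} {B : Subset n} {i b c} → punchIn i c ∈ₛ insertAt B i b → c ∈ₛ B
∈-insertAt⁻ {B = B} {i} {b} {c} c∈B′ =
  lookup⇒[]= c B (trans (sym (insertAt-punchIn B i b c)) ([]=⇒lookup c∈B′))

inserted∈ : ∀ {n} (B : Subset n) i → i ∈ₛ insertAt B i true
inserted∈ B i = lookup⇒[]= i (insertAt B i true) (insertAt-lookup B i true)

inserted∉ : ∀ {n} (B : Subset n) i → i ∉ₛ insertAt B i false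
inserted∉ B i = lookup⇒∉ (insertAt-lookup B i false)

missesOne : ∀ {n} (S : Subset n) → 1 ≤ n → ∣ S ∣ ≡ n ∸ 1 →
  ∃ λ w → w ∉ₛ S × (∀ v → v ≢ w → v ∈ₛ S)
missesOne {n} S n≥1 ∣S∣≡n-1 = w , w∉S , others∈S
  where
  n≰n∸1 : ∀ {m} → 1 ≤ m → ¬ (m ≤ m ∸ 1)
  n≰n∸1 {suc m} _ = 1+n≰n
  -- S is not full, since it is smaller than ⊤
  missing : ∃ λ w → w ∉ₛ S
  missing = ¬∀⟶∃¬ n (_∈ₛ S) (_∈? S) λ all∈S →
    n≰n∸1 n≥1 (subst₂ _≤_ (∣⊤∣≡n n) ∣S∣≡n-1 (p⊆q⇒∣p∣≤∣q∣ {p = ⊤} (λ {v} _ → all∈S v)))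
  w = proj₁ missing
  w∉S = proj₂ missing
  -- adding a second missing element v would give a full subset still missing w
  others∈S : ∀ v → v ≢ w → v ∈ₛ S
  others∈S v v≢w with v ∈? S
  ... | yes v∈S = v∈S
  ... | no v∉S  = contradiction (subst (w ∈ₛ_) (sym (∣p∣≡n⇒p≡⊤ ∣S+v∣≡n)) ∈⊤) w∉S+v
    where
    S+v = S [ v ]≔ true
    ∣S+v∣≡n : ∣ S+v ∣ ≡ n
    ∣S+v∣≡n = begin
      ∣ S+v ∣                      ≡⟨ +-identityʳ _ ⟨
      ∣ S+v ∣ + bit false          ≡⟨ cong (λ b → ∣ S+v ∣ + bit b) (∉⇒lookup v∉S) ⟨
      ∣ S+v ∣ + bit (lookup S v)   ≡⟨ ∣update∣ S v true ⟩
      ∣ S ∣ + 1                    ≡⟨ cong (_+ 1) ∣S∣≡n-1 ⟩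
      n ∸ 1 + 1                    ≡⟨ m∸n+n≡m n≥1 ⟩
      n                            ∎
      where open ≡-Reasoning
    w∉S+v : w ∉ₛ S+v
    w∉S+v w∈S+v = w∉S (∈-update⁻ (≢-sym v≢w) w∈S+v)

module _ {n m : ℕ} (G : Digraph n) (H : Digraph m) (g : Fin n → Fin m) (P : Fin n → Set)
         (arc↦arc : ∀ {a b} → P a → P b → Arc G a b → Arc H (g a) (g b)) where

  mapPath : ∀ {x y vs} → Path G x y vs → All P vs → Path H (g x) (g y) (map g vs)
  mapPath (single x)            _                   = single (g x)
  mapPath (step a (single y))   (px ∷ py ∷ [])      = step (arc↦arc px py a) (single (g y))
  mapPath (step a q@(step _ _)) (px ∷ pvs@(py ∷ _)) = step (arc↦arc px py a) (mapPath q pvs)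

PathWithin : ∀ {n} → Digraph n → (Fin n → Set) → Fin n → Fin n → Set
PathWithin G P a b = ∃ λ vs → Path G a b vs × All P vs

transferStrong : ∀ {n m} {G : Digraph n} {H : Digraph m} {B : Subset n} {A : Subset m} (g : Fin n → Fin m) →
  (∀ {a b} → a ∉ₛ B → b ∉ₛ B → Arc G a b → Arc H (g a) (g b)) →
  (∀ {v} → v ∉ₛ B → g v ∉ₛ A) →
  (∀ x → x ∉ₛ A → ∃ λ v → v ∉ₛ B × g v ≡ x) →
  StronglyConnectedMinus G B → StronglyConnectedMinus H A
transferStrong {G = G} {H} {B} {A} g arc↦arc avoid↦avoid onto strongG x y x∉A y∉A
  with onto x x∉A | onto y y∉A
... | u , u∉B , refl | v , v∉B , refl with strongG u v u∉B v∉B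
...   | vs , u⋯v , vs∉B =
  map g vs , mapPath G H g (_∉ₛ B) arc↦arc u⋯v vs∉B , Allₚ.map⁺ (All.map avoid↦avoid vs∉B)

module _ {n : ℕ} {G : Digraph n} where

  allHead : ∀ {P : Fin n → Set} {x y vs} → Path G x y vs → All P vs → P x
  allHead (single _) (px ∷ _) = px
  allHead (step _ _) (px ∷ _) = px

  head∈ : ∀ {x y vs} → Path G x y vs → x ∈ vs
  head∈ (single _) = here refl
  head∈ (step _ _) = here refl

  allLast : ∀ {P : Fin n → Set} {x y vs} → Path G x y vs → All P vs → P y
  allLast (single _) (py ∷ []) = py
  allLast (step _ q) (_ ∷ ps)  = allLast q ps

  appendPath : ∀ {a b c vs ws} → Path G a b vs → Path G b c (b ∷ ws) → Path G a c (vs ++ ws)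
  appendPath (single _) q = q
  appendPath (step e p) q = step e (appendPath p q)

  joinPaths : ∀ {P : Fin n → Set} {a b c} → PathWithin G P a b → PathWithin G P b c → PathWithin G P a c
  joinPaths (_ , single _ , _)        q = q
  joinPaths (_ ∷ vs , step e p , Pa ∷ Pvs) q with joinPaths (vs , p , Pvs) q
  ... | us , r , Pus = _ , step e r , Pa ∷ Pus

  splitPath : ∀ as {p q c bs} → Path G p q (as ++ c ∷ bs) → Path G p c (as ++ c ∷ []) × Path G c q (c ∷ bs)
  splitPath []                   (single c)           = single c , single c
  splitPath []                   (step e r)           = single _ , step e r
  splitPath (a ∷ [])             (step e (single c))  = step e (single c) , single c
  splitPath (a ∷ [])             (step e (step e′ r)) = step e (single _) , step e′ r
  splitPath (a ∷ as@(_ ∷ _))     (step e r) with splitPath as r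
  ... | r₁ , r₂ = step e r₁ , r₂

  unsnoc : ∀ {x y vs} → Path G x y vs → x ≢ y →
    ∃ λ z → ∃ λ us → Path G x z us × Arc G z y × vs ≡ us ++ y ∷ []
  unsnoc (single _) x≢x = ⊥-elim (x≢x refl)
  unsnoc (step a p) _   = viaArc a p
    where
    viaArc : ∀ {x x′ y rest} → Arc G x x′ → Path G x′ y rest →
      ∃ λ z → ∃ λ us → Path G x z us × Arc G z y × x ∷ rest ≡ us ++ y ∷ []
    viaArc {x} a (single _) = x , x ∷ [] , single x , a , refl
    viaArc {x} a (step b q) with viaArc b q
    ... | z , us , r , c , eq = z , x ∷ us , step a r , c , cong (x ∷_) eq

  firstVisit : ∀ {P : Fin n → Set} {x y vs} → Path G x y vs → All P vs → x ≢ y →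
    ∃ λ c → ∃ λ ws → Path G x c ws × Arc G c y × All (λ v → P v × v ≢ y) ws
  firstVisit (single _) _ x≢x = ⊥-elim (x≢x refl)
  firstVisit {x = x} {y} (step {y = x′} a p) (Px ∷ Pvs) x≢y with x′ ≟ y
  ... | yes refl = x , x ∷ [] , single x , a , (Px , x≢y) ∷ []
  ... | no x′≢y with firstVisit p Pvs x′≢y
  ...   | c , ws , r , a′ , Pws = c , x ∷ ws , step a r , a′ , (Px , x≢y) ∷ Pws

  lastVisit : ∀ {P : Fin n → Set} {x y vs} (v : Fin n) → Path G x y vs → All P vs → v ≢ y → v ∈ vs →
    ∃ λ c → ∃ λ ws → Arc G v c × Path G c y ws × All (λ u → P u × u ≢ v) ws
  lastVisit v (single _) _ v≢v (here refl) = ⊥-elim (v≢v refl)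
  lastVisit {x = x} v (step {y = x′} {vs = rest} a p) (_ ∷ Prest) v≢y v∈vs with any? (v ≟_) rest
  ... | yes v∈rest = lastVisit v p Prest v≢y v∈rest
  ... | no v∉rest with v∈vs
  ...   | there v∈rest = ⊥-elim (v∉rest v∈rest)
  ...   | here refl    = x′ , rest , a , p , avoid Prest v∉rest
    where
    avoid : ∀ {P : Fin n → Set} {us} → All P us → v ∉ us → All (λ u → P u × u ≢ v) us
    avoid []         _    = []
    avoid (Pu ∷ Pus) v∉us = (Pu , λ u≡v → v∉us (here (sym u≡v))) ∷ avoid Pus (λ v∈ → v∉us (there v∈))

  closeWalk : ∀ {a b p v vs} ws → Path G a b vs → Arc G b p → Path G p v (ws ++ v ∷ []) →
    ∃ λ u → Path G a u (vs ++ ws) × Arc G u v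
  closeWalk []               (single _) a (single _)  = _ , single _ , a
  closeWalk (_ ∷ [])         (single _) a (step a′ q) with closeWalk [] (single _) a′ q
  ... | u , r , c = u , step a r , c
  closeWalk (_ ∷ ws@(_ ∷ _)) (single _) a (step a′ q) with closeWalk ws (single _) a′ q
  ... | u , r , c = u , step a r , c
  closeWalk ws               (step e p) a q           with closeWalk ws p a q
  ... | u , r , c = u , step e r , c

module _ {A : Set} where

  rotate↭ : ∀ (as : List A) v bs → as ++ v ∷ bs ↭ v ∷ bs ++ as
  rotate↭ as v bs = ↭-trans (shift v as bs) (↭-prep v (++-comm as bs))

  unique-rotate : ∀ (as : List A) {v bs} → Unique (as ++ v ∷ bs) → Unique (v ∷ bs ++ as)
  unique-rotate as {v} {bs} = Permutationₛ.Unique-resp-↭ (setoid A) (↭⇒↭ₛ (rotate↭ as v bs))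

  unique-∷ʳ⁻ : ∀ (xs : List A) {y} → Unique (xs ++ y ∷ []) → All (_≢ y) xs × Unique xs
  unique-∷ʳ⁻ []       _          = [] , []
  unique-∷ʳ⁻ (x ∷ xs) (x∉ ∷ uniq) with unique-∷ʳ⁻ xs uniq
  ... | xs≢y , uniq′ = x≢y ∷ xs≢y , Allₚ.++⁻ˡ xs x∉ ∷ uniq′
    where
    x≢y : x ≢ _
    x≢y with Allₚ.++⁻ʳ xs x∉
    ... | x≢y ∷ [] = x≢y

unique-map : ∀ {A B : Set} {P : A → Set} (g : A → B) → (∀ {a b} → P a → P b → g a ≡ g b → a ≡ b) →
  ∀ {xs} → All P xs → Unique xs → Unique (map g xs)
unique-map g inj []         []          = []
unique-map {P = P} g inj (Px ∷ Pxs) (x∉ ∷ uniq) = distinct Px Pxs x∉ ∷ unique-map g inj Pxs uniq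
  where
  distinct : ∀ {x ys} → P x → All P ys → All (x ≢_) ys → All (g x ≢_) (map g ys)
  distinct Px []         []          = []
  distinct Px (Py ∷ Pys) (x≢y ∷ x≢ys) = (λ gx≡gy → x≢y (inj Px Py gx≡gy)) ∷ distinct Px Pys x≢ys

hamiltonianFrom : ∀ {n} {G : Digraph n} → Hamiltonian G → ∀ v → ∃ λ u → HamPath G v u × Arc G u v
hamiltonianFrom {G = G} (p , q , (vs , path , uniq , cover) , q→p) v with ∈-∃++ (cover v)
... | as , bs , refl with splitPath as path
...   | p⋯v , v⋯q with closeWalk as v⋯q q→p p⋯v
...     | u , v⋯u , u→v =
  u , (v ∷ bs ++ as , v⋯u , unique-rotate as uniq , λ w → ∈-resp-↭ (rotate↭ as v bs) (cover w)) , u→v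

_==_ : ∀ {n} → Fin n → Fin n → Bool
i == j = does (i ≟ j)

==-refl : ∀ {n} (i : Fin n) → (i == i) ≡ true
==-refl i = dec-true (i ≟ i) refl

==-≢ : ∀ {n} {i j : Fin n} → i ≢ j → (i == j) ≡ false
==-≢ {i = i} {j} i≢j = dec-false (i ≟ j) i≢j

noLoop : ∀ {n} (G : Digraph n) {u} → ¬ Arc G u u
noLoop G {u} a with trans (sym a) (Digraph.loopless G u)
... | ()

-- From D and a vertex w we build D⁺ on one more vertex:
-- 'suc v' is the copy of v, and the new vertex 'zero' is a second copy
-- of w that receives the in-arcs of w.  Moreover 'zero' dominates all
-- other vertices, w's copy dominates 'zero', and every vertex dominates
-- w's copy.  A Hamiltonian path of D⁺ from w's copy to 'zero' is then a
-- Hamiltonian cycle of D through w.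
module Split {n : ℕ} (D : Digraph n) (w : Fin n) where
  open Digraph D

  adj⁺ : Fin (suc n) → Fin (suc n) → Bool
  adj⁺ zero    zero    = false
  adj⁺ zero    (suc j) = true
  adj⁺ (suc i) zero    = (i == w) ∨ adj i w
  adj⁺ (suc i) (suc j) = if j == w then not (i == w) else adj i j

  loopless⁺ : ∀ x → adj⁺ x x ≡ false
  loopless⁺ zero    = refl
  loopless⁺ (suc i) with i == w
  ... | true  = refl
  ... | false = loopless i

  D⁺ : Digraph (suc n)
  D⁺ = record { adj = adj⁺ ; loopless = loopless⁺ }

  into-new : ∀ {i} → i ≢ w → adj⁺ (suc i) zero ≡ adj i w
  into-new i≢w rewrite ==-≢ i≢w = refl

  w→new : adj⁺ (suc w) zero ≡ true
  w→new rewrite ==-refl w = refl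

  old→old : ∀ {i j} → j ≢ w → adj⁺ (suc i) (suc j) ≡ adj i j
  old→old j≢w rewrite ==-≢ j≢w = refl

  into-w : ∀ {i} → i ≢ w → adj⁺ (suc i) (suc w) ≡ true
  into-w i≢w rewrite ==-refl w | ==-≢ i≢w = refl

  -- Degrees in D⁺: every vertex gains two, except that w's two copies
  -- share the arcs of w and the new arcs around them.
  indeg-new : indeg D⁺ zero ≡ indeg D w + 1
  indeg-new = begin
    count from-old                               ≡⟨ +-identityʳ _ ⟨
    count from-old + bit false                   ≡⟨ cong (λ b → count from-old + bit b) (loopless w) ⟨
    count from-old + bit (adj w w)               ≡⟨ count-update from-old (λ j → adj j w) w (λ i i≢w → into-new i≢w) ⟩
    indeg D w + bit (adj⁺ (suc w) zero)          ≡⟨ cong (λ b → indeg D w + bit b) w→new ⟩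
    indeg D w + 1                                ∎
    where
    open ≡-Reasoning
    from-old : Fin n → Bool
    from-old j = adj⁺ (suc j) zero

  outdeg-w : outdeg D⁺ (suc w) ≡ 1 + outdeg D w
  outdeg-w = cong₂ (λ b c → bit b + c) w→new (count-cong same)
    where
    same : ∀ j → adj⁺ (suc w) (suc j) ≡ adj w j
    same j = byCases (j ≟ w)
      where
      byCases : Dec (j ≡ w) → adj⁺ (suc w) (suc j) ≡ adj w j
      byCases (yes refl) = trans (loopless⁺ (suc w)) (sym (loopless w))
      byCases (no j≢w)   = old→old j≢w

  indeg-w : indeg D⁺ (suc w) ≡ n
  indeg-w = begin
    1 + count from-old                           ≡⟨ +-comm 1 _ ⟩
    count from-old + bit true                    ≡⟨ count-update from-old (λ _ → true) w (λ i i≢w → into-w i≢w) ⟩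
    count always + bit (adj⁺ (suc w) (suc w))    ≡⟨ cong (λ b → count always + bit b) (loopless⁺ (suc w)) ⟩
    count always + 0                             ≡⟨ +-identityʳ _ ⟩
    count always                                 ≡⟨ count-all n ⟩
    n                                            ∎
    where
    open ≡-Reasoning
    from-old always : Fin n → Bool
    from-old j = adj⁺ (suc j) (suc w)
    always _ = true

  outdeg-old : ∀ {i} → i ≢ w → outdeg D⁺ (suc i) ≡ outdeg D i + 1
  outdeg-old {i} i≢w = begin
    bit (adj⁺ (suc i) zero) + count to-old       ≡⟨ +-comm (bit (adj⁺ (suc i) zero)) _ ⟩
    count to-old + bit (adj⁺ (suc i) zero)       ≡⟨ cong (λ b → count to-old + bit b) (into-new i≢w) ⟩
    count to-old + bit (adj i w)                 ≡⟨ count-update to-old (adj i) w (λ j j≢w → old→old j≢w) ⟩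
    outdeg D i + bit (adj⁺ (suc i) (suc w))      ≡⟨ cong (λ b → outdeg D i + bit b) (into-w i≢w) ⟩
    outdeg D i + 1                               ∎
    where
    open ≡-Reasoning
    to-old : Fin n → Bool
    to-old j = adj⁺ (suc i) (suc j)

  indeg-old : ∀ {i} → i ≢ w → indeg D⁺ (suc i) ≡ 1 + indeg D i
  indeg-old {i} i≢w = cong suc (count-cong (λ j → old→old {j} i≢w))

  deg-new : deg D⁺ zero ≡ n + (indeg D w + 1)
  deg-new = cong₂ _+_ (count-all n) indeg-new

  deg-w : deg D⁺ (suc w) ≡ 1 + outdeg D w + n
  deg-w = cong₂ _+_ outdeg-w indeg-w

  deg-old : ∀ {i} → i ≢ w → deg D⁺ (suc i) ≡ deg D i + 2
  deg-old {i} i≢w = trans (cong₂ _+_ (outdeg-old i≢w) (indeg-old i≢w)) (regroup (outdeg D i) (indeg D i))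
    where
    regroup : ∀ o d → o + 1 + (1 + d) ≡ o + d + 2
    regroup = solve-∀

  minDegree⁺ : (∀ v → v ≢ w → n ≤ deg D v) → 1 ≤ outdeg D w → 1 ≤ indeg D w → ∀ x → n + 2 ≤ deg D⁺ x
  minDegree⁺ deg≥n out≥1 in≥1 zero =
    subst (n + 2 ≤_) (sym deg-new) (+-monoʳ-≤ n (+-monoˡ-≤ 1 in≥1))
  minDegree⁺ deg≥n out≥1 in≥1 (suc i) = byCases (i ≟ w)
    where
    byCases : Dec (i ≡ w) → n + 2 ≤ deg D⁺ (suc i)
    byCases (yes refl) = subst₂ _≤_ (+-comm 2 n) (sym deg-w) (+-monoˡ-≤ n (s≤s out≥1))
    byCases (no i≢w)   = subst (n + 2 ≤_) (sym (deg-old i≢w)) (+-monoˡ-≤ 2 (deg≥n i i≢w))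

  arc-suc : ∀ {u v} → Arc D u v → Arc D⁺ (suc u) (suc v)
  arc-suc {u} {v} a = byCases (u ≟ w) (v ≟ w)
    where
    byCases : Dec (u ≡ w) → Dec (v ≡ w) → Arc D⁺ (suc u) (suc v)
    byCases (yes refl) (yes refl) = contradiction a (noLoop D)
    byCases (no u≢w)   (yes refl) = into-w u≢w
    byCases _          (no v≢w)   = trans (old→old v≢w) a

  φ : Fin n → Fin (suc n)
  φ v = if v == w then zero else suc v

  φ-w : φ w ≡ zero
  φ-w rewrite ==-refl w = refl

  φ-≢ : ∀ {v} → v ≢ w → φ v ≡ suc v
  φ-≢ v≢w rewrite ==-≢ v≢w = refl

  arc-φ : ∀ {u v} → Arc D u v → Arc D⁺ (φ u) (φ v)
  arc-φ {u} {v} a = byCases (u ≟ w) (v ≟ w)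
    where
    byCases : Dec (u ≡ w) → Dec (v ≡ w) → Arc D⁺ (φ u) (φ v)
    byCases (yes refl) (yes refl) = contradiction a (noLoop D)
    byCases (yes refl) (no v≢w)   rewrite φ-w | φ-≢ v≢w = refl
    byCases (no u≢w)   (yes refl) rewrite φ-w | φ-≢ u≢w = trans (into-new u≢w) a
    byCases (no u≢w)   (no v≢w)   rewrite φ-≢ u≢w | φ-≢ v≢w = trans (old→old v≢w) a

  -- If D - B is strong for all |B| < k, then D⁺ - A is strong for all
  -- |A| ≤ k: when the new vertex survives but w's copy does not, the new
  -- vertex takes over the role of w; when both survive, every vertex
  -- reaches the new vertex through w's copy and is reached from it.
  strong⁺ : ∀ k → (∀ B → ∣ B ∣ ≤ k ∸ 1 → StronglyConnectedMinus D B) →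
    ∀ A → ∣ A ∣ ≤ k → StronglyConnectedMinus D⁺ A
  strong⁺ k strongD (true ∷ A) ∣A∣<k =
    transferStrong suc (λ _ _ → arc-suc) (λ v∉A → λ { (there v∈A) → v∉A v∈A }) onto
                   (strongD A (∸-monoˡ-≤ 1 ∣A∣<k))
    where
    onto : ∀ x → x ∉ₛ true ∷ A → ∃ λ v → v ∉ₛ A × suc v ≡ x
    onto zero    new∉ = contradiction here new∉
    onto (suc i) i∉   = i , (λ i∈A → i∉ (there i∈A)) , refl
  strong⁺ k strongD (false ∷ A) ∣A∣≤k with w ∈? A
  ... | yes w∈A = transferStrong φ (λ _ _ → arc-φ) avoid onto (strongD A′ ∣A′∣<k)
    where
    A′ = A [ w ]≔ false
    ∣A′∣<k : ∣ A′ ∣ ≤ k ∸ 1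
    ∣A′∣<k = ∸-monoˡ-≤ 1 (subst (_≤ k) ∣A∣≡∣A′∣+1 ∣A∣≤k)
      where
      ∣A∣≡∣A′∣+1 : ∣ A ∣ ≡ 1 + ∣ A′ ∣
      ∣A∣≡∣A′∣+1 = begin
        ∣ A ∣                          ≡⟨ +-identityʳ _ ⟨
        ∣ A ∣ + bit false              ≡⟨ ∣update∣ A w false ⟨
        ∣ A′ ∣ + bit (lookup A w)      ≡⟨ cong (λ b → ∣ A′ ∣ + bit b) (∈⇒lookup w∈A) ⟩
        ∣ A′ ∣ + 1                     ≡⟨ +-comm _ 1 ⟩
        1 + ∣ A′ ∣                     ∎
        where open ≡-Reasoning
    avoid : ∀ {v} → v ∉ₛ A′ → φ v ∉ₛ false ∷ A
    avoid {v} v∉A′ = byCases (v ≟ w)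
      where
      byCases : Dec (v ≡ w) → φ v ∉ₛ false ∷ A
      byCases (yes refl) rewrite φ-w  = λ ()
      byCases (no v≢w)   rewrite φ-≢ v≢w = λ { (there v∈A) → v∉A′ ([]≔-minimal A v w v≢w v∈A) }
    onto : ∀ x → x ∉ₛ false ∷ A → ∃ λ v → v ∉ₛ A′ × φ v ≡ x
    onto zero    _  = w , ∉-updated A w , φ-w
    onto (suc i) i∉ = i , (λ i∈A′ → i∉ (there (∈-update⁻ i≢w i∈A′))) , φ-≢ i≢w
      where
      i≢w : i ≢ w
      i≢w refl = i∉ (there w∈A)
  ... | no w∉A = λ x y x∉ y∉ → joinPaths (toNew x x∉) (fromNew y y∉)
    where
    toNew : ∀ x → x ∉ₛ false ∷ A → PathWithin D⁺ (_∉ₛ false ∷ A) x zero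
    toNew zero    _  = _ , single zero , (λ ()) ∷ []
    toNew (suc i) i∉ = byCases (i ≟ w)
      where
      w∉ : suc w ∉ₛ false ∷ A
      w∉ (there w∈A) = w∉A w∈A
      byCases : Dec (i ≡ w) → PathWithin D⁺ (_∉ₛ false ∷ A) (suc i) zero
      byCases (yes refl) = _ , step w→new (single zero) , i∉ ∷ (λ ()) ∷ []
      byCases (no i≢w)   = _ , step (into-w i≢w) (step w→new (single zero)) , i∉ ∷ w∉ ∷ (λ ()) ∷ []
    fromNew : ∀ y → y ∉ₛ false ∷ A → PathWithin D⁺ (_∉ₛ false ∷ A) zero y
    fromNew zero    _  = _ , single zero , (λ ()) ∷ []
    fromNew (suc j) j∉ = _ , step refl (single (suc j)) , (λ ()) ∷ j∉ ∷ []

  kStrong⁺ : ∀ {k} → KStrong D k → KStrong D⁺ (k + 1)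
  kStrong⁺ {k} (k+1≤n , strongD) =
    subst (_≤ suc n) (+-comm 1 (k + 1)) (s≤s k+1≤n) ,
    λ A ∣A∣≤k → strong⁺ k strongD A (subst (∣ A ∣ ≤_) (m+n∸n≡m k 1) ∣A∣≤k)

  merge : Fin (suc n) → Fin n
  merge zero    = w
  merge (suc i) = i

  -- The vertices strictly inside a Hamiltonian path from w's copy to the new vertex.
  Inner : Fin (suc n) → Set
  Inner v = v ≢ zero × v ≢ suc w

  arc⁻ : ∀ {a b} → a ≢ zero → Inner b → Arc D⁺ a b → Arc D (merge a) (merge b)
  arc⁻ {zero}          a≢0 _         _ = contradiction refl a≢0
  arc⁻ {suc i} {zero}  _   (b≢0 , _) _ = contradiction refl b≢0
  arc⁻ {suc i} {suc j} _   (_ , b≢w) a = trans (sym (old→old (λ j≡w → b≢w (cong suc j≡w)))) a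

  arc-into-new⁻ : ∀ {a} → Inner a → Arc D⁺ a zero → Arc D (merge a) w
  arc-into-new⁻ {zero}  (a≢0 , _) _ = contradiction refl a≢0
  arc-into-new⁻ {suc i} (_ , a≢w) a = trans (sym (into-new (λ i≡w → a≢w (cong suc i≡w)))) a

  merge-inner≢w : ∀ {v} → Inner v → w ≢ merge v
  merge-inner≢w {zero}  (v≢0 , _) _   = v≢0 refl
  merge-inner≢w {suc i} (_ , v≢w) w≡i = v≢w (cong suc (sym w≡i))

  merge-injective : ∀ {a b} → Inner a → Inner b → merge a ≡ merge b → a ≡ b
  merge-injective {zero}          (a≢0 , _) _         _  = contradiction refl a≢0
  merge-injective {suc i} {zero}  _         (b≢0 , _) _  = contradiction refl b≢0
  merge-injective {suc i} {suc j} _         _         eq = cong suc eq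

  hamiltonian⁻ : ∀ o → o ≢ w → HamPath D⁺ (suc w) zero → Hamiltonian D
  hamiltonian⁻ o o≢w (vs , path , uniq , cover) with unsnoc path (λ ())
  ... | _ , _ ∷ [] , single _ , _ , refl with cover (suc o)
  ...   | here o≡w          = ⊥-elim (o≢w (Fin-suc-injective o≡w))
  ...   | there (here ())
  ...   | there (there ())
  hamiltonian⁻ o o≢w (vs , path , (w∉ ∷ uniq) , cover)
      | z , _ ∷ us , step w→x x⋯z , z→new , refl =
    w , merge z , (w ∷ map merge us , path⁻ , w∉us⁻ ∷ unique-map merge merge-injective inner uniq⁻ , cover⁻) ,
    arc-into-new⁻ (allLast x⋯z inner) z→new
    where
    us≢new×uniq⁻ = unique-∷ʳ⁻ us uniq
    uniq⁻ = proj₂ us≢new×uniq⁻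
    inner : All Inner us
    inner = All.zip (proj₁ us≢new×uniq⁻ , All.map ≢-sym (Allₚ.++⁻ˡ us w∉))
    path⁻ : Path D w (merge z) (w ∷ map merge us)
    path⁻ = step (arc⁻ {suc w} (λ ()) (allHead x⋯z inner) w→x)
                 (mapPath D⁺ D merge Inner (λ Pa Pb → arc⁻ (proj₁ Pa) Pb) x⋯z inner)
    w∉us⁻ : All (w ≢_) (map merge us)
    w∉us⁻ = Allₚ.map⁺ (All.map merge-inner≢w inner)
    cover⁻ : ∀ v → v ∈ w ∷ map merge us
    cover⁻ v with v ≟ w | cover (suc v)
    ... | yes refl | _               = here refl
    ... | no v≢w   | here v≡w        = ⊥-elim (v≢w (Fin-suc-injective v≡w))
    ... | no v≢w   | there v∈us++new with ∈-++⁻ us v∈us++new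
    ...   | inj₁ v∈us       = there (∈-map⁺ merge v∈us)
    ...   | inj₂ (here ())
    ...   | inj₂ (there ())

-- From D on n + 1 vertices and distinct x, y we
-- build D⁻ = D - y on Fin n, in which the copy z of x keeps the out-arcs
-- of x but has the in-arcs of y instead of its own.  A Hamiltonian cycle
-- of D⁻ then unfolds into a Hamiltonian path of D from x to y.
module Contract {n : ℕ} (D : Digraph (suc n)) (x y : Fin (suc n)) (x≢y : x ≢ y) where
  open Digraph D

  -- The vertices of D - y, and the one among them that is x.
  h : Fin n → Fin (suc n)
  h = punchIn y

  z : Fin n
  z = punchOut (≢-sym x≢y)

  h-z : h z ≡ x
  h-z = punchIn-punchOut _

  adj⁻ : Fin n → Fin n → Bool
  adj⁻ a b = if b == z then not (a == z) ∧ adj (h a) y else adj (h a) (h b)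

  loopless⁻ : ∀ a → adj⁻ a a ≡ false
  loopless⁻ a with a == z
  ... | true  = refl
  ... | false = loopless (h a)

  D⁻ : Digraph n
  D⁻ = record { adj = adj⁻ ; loopless = loopless⁻ }

  kept : ∀ {a b} → b ≢ z → adj⁻ a b ≡ adj (h a) (h b)
  kept b≢z rewrite ==-≢ b≢z = refl

  into-z : ∀ {a} → a ≢ z → adj⁻ a z ≡ adj (h a) y
  into-z a≢z rewrite ==-refl z | ==-≢ a≢z = refl

  -- Away from z, a vertex loses at most its arcs to x and from y.
  outdeg-drop : ∀ {v} → v ≢ z → outdeg D⁻ v + bit (adj (h v) x) ≡ outdeg D (h v)
  outdeg-drop {v} v≢z = begin
    outdeg D⁻ v + bit (adj (h v) x)        ≡⟨ cong (λ u → outdeg D⁻ v + bit (adj (h v) u)) h-z ⟨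
    outdeg D⁻ v + bit (adj (h v) (h z))    ≡⟨ count-update (adj⁻ v) to-rest z (λ b b≢z → kept b≢z) ⟩
    count to-rest + bit (adj⁻ v z)         ≡⟨ cong (λ c → count to-rest + bit c) (into-z v≢z) ⟩
    count to-rest + bit (adj (h v) y)      ≡⟨ count-punchIn y (adj (h v)) ⟩
    outdeg D (h v)                         ∎
    where
    open ≡-Reasoning
    to-rest : Fin n → Bool
    to-rest b = adj (h v) (h b)

  indeg-drop : ∀ {v} → v ≢ z → indeg D⁻ v + bit (adj y (h v)) ≡ indeg D (h v)
  indeg-drop {v} v≢z = begin
    indeg D⁻ v + bit (adj y (h v))                    ≡⟨ cong (_+ bit (adj y (h v))) (count-cong (λ a → kept {a} v≢z)) ⟩
    count (λ a → adj (h a) (h v)) + bit (adj y (h v)) ≡⟨ count-punchIn y (λ a → adj a (h v)) ⟩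
    indeg D (h v)                                     ∎
    where open ≡-Reasoning

  minDegree⁻ : (∀ u → n + 2 ≤ deg D u) → ∀ v → v ≢ z → n ≤ deg D⁻ v
  minDegree⁻ deg≥n+2 v v≢z = +-cancelʳ-≤ 2 n (deg D⁻ v) (begin
    n + 2                                                          ≤⟨ deg≥n+2 (h v) ⟩
    deg D (h v)                                                    ≡⟨ cong₂ _+_ (outdeg-drop v≢z) (indeg-drop v≢z) ⟨
    outdeg D⁻ v + bit (adj (h v) x) + (indeg D⁻ v + bit (adj y (h v)))
      ≤⟨ +-mono-≤ (+-monoʳ-≤ (outdeg D⁻ v) (bit≤1 _)) (+-monoʳ-≤ (indeg D⁻ v) (bit≤1 _)) ⟩
    outdeg D⁻ v + 1 + (indeg D⁻ v + 1)                             ≡⟨ regroup (outdeg D⁻ v) (indeg D⁻ v) ⟩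
    deg D⁻ v + 2                                                   ∎)
    where
    open ≤-Reasoning
    regroup : ∀ o d → o + 1 + (d + 1) ≡ o + d + 2
    regroup = solve-∀

  -- The inverse of h on D - y, sending y to z.
  back : Fin (suc n) → Fin n
  back v = byCases (y ≟ v)
    where
    byCases : Dec (y ≡ v) → Fin n
    byCases (yes _)   = z
    byCases (no y≢v)  = punchOut y≢v

  h-back : ∀ {v} → v ≢ y → h (back v) ≡ v
  h-back {v} v≢y with y ≟ v
  ... | yes y≡v = contradiction (sym y≡v) v≢y
  ... | no y≢v  = punchIn-punchOut y≢v

  back-h : ∀ b → back (h b) ≡ b
  back-h b = punchIn-injective y _ _ (h-back (punchInᵢ≢i y b))

  back≢z : ∀ {v} → v ≢ x → v ≢ y → back v ≢ z
  back≢z v≢x v≢y back≡z = v≢x (trans (sym (h-back v≢y)) (trans (cong h back≡z) h-z))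

  Outside : Fin (suc n) → Set
  Outside v = v ≢ x × v ≢ y

  arc-outside : ∀ {a b} → Outside a → Outside b → Arc D a b → Arc D⁻ (back a) (back b)
  arc-outside (_ , a≢y) (b≢x , b≢y) a→b =
    trans (kept (back≢z b≢x b≢y)) (subst₂ (λ p q → adj p q ≡ true) (sym (h-back a≢y)) (sym (h-back b≢y)) a→b)

  arc-into-z : ∀ {a} → Outside a → Arc D a y → Arc D⁻ (back a) z
  arc-into-z (a≢x , a≢y) a→y = trans (into-z (back≢z a≢x a≢y)) (subst (λ p → adj p y ≡ true) (sym (h-back a≢y)) a→y)

  arc-from-z : ∀ {b} → Outside b → Arc D x b → Arc D⁻ z (back b)
  arc-from-z (b≢x , b≢y) x→b =
    trans (kept (back≢z b≢x b≢y)) (subst₂ (λ p q → adj p q ≡ true) (sym h-z) (sym (h-back b≢y)) x→b)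

  project : ∀ {Q : Fin (suc n) → Set} {B : Subset n} {a b} → (∀ {v} → Q v → Outside v × back v ∉ₛ B) →
    PathWithin D Q a b → PathWithin D⁻ (_∉ₛ B) (back a) (back b)
  project {Q} good (vs , a⋯b , Qvs) =
    map back vs , mapPath D D⁻ back Q (λ Qa Qb → arc-outside (proj₁ (good Qa)) (proj₁ (good Qb))) a⋯b Qvs ,
    Allₚ.map⁺ (All.map (λ Qv → proj₂ (good Qv)) Qvs)

  module Routes (k : ℕ) (strongD : ∀ A → ∣ A ∣ ≤ k → StronglyConnectedMinus D A)
                (B : Subset n) (∣B∣+1≤k : ∣ B ∣ + 1 ≤ k) where

    -- If z ∈ B, delete y as well and project.
    avoidingZ : z ∈ₛ B → StronglyConnectedMinus D⁻ B
    avoidingZ z∈B a b a∉B b∉B = subst₂ (PathWithin D⁻ (_∉ₛ B)) (back-h a) (back-h b)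
      (project good (strongD A ∣A∣≤k (h a) (h b) (avoid a∉B) (avoid b∉B)))
      where
      A = insertAt B y true
      ∣A∣≤k : ∣ A ∣ ≤ k
      ∣A∣≤k = subst (_≤ k) (sym (∣insertAt∣ B y true)) ∣B∣+1≤k
      avoid : ∀ {c} → c ∉ₛ B → h c ∉ₛ A
      avoid c∉B hc∈A = c∉B (∈-insertAt⁻ hc∈A)
      good : ∀ {v} → v ∉ₛ A → Outside v × back v ∉ₛ B
      good {v} v∉A = (v≢x , v≢y) , λ back∈B → v∉A (subst (_∈ₛ A) (h-back v≢y) (∈-insertAt⁺ back∈B))
        where
        v≢y : v ≢ y
        v≢y refl = v∉A (inserted∈ B y)
        v≢x : v ≢ x
        v≢x refl = v∉A (subst (_∈ₛ A) h-z (∈-insertAt⁺ z∈B))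

    -- If z ∉ B, a walk of D - (B ∪ {x}) from h a to y, cut at its first
    -- visit of y, projects to a walk from a to z.
    toZ : z ∉ₛ B → ∀ a → a ∉ₛ B → PathWithin D⁻ (_∉ₛ B) a z
    toZ z∉B a a∉B with a ≟ z
    ... | yes refl = _ , single z , a∉B ∷ []
    ... | no a≢z   = cutAtY (strongD A ∣A∣≤k (h a) y ha∉A (inserted∉ _ y))
      where
      A = insertAt (B [ z ]≔ true) y false
      ∣A∣≤k : ∣ A ∣ ≤ k
      ∣A∣≤k = subst (_≤ k) (sym ∣A∣≡∣B∣+1) ∣B∣+1≤k
        where
        ∣A∣≡∣B∣+1 : ∣ A ∣ ≡ ∣ B ∣ + 1
        ∣A∣≡∣B∣+1 = begin
          ∣ A ∣                                 ≡⟨ ∣insertAt∣ (B [ z ]≔ true) y false ⟩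
          ∣ B [ z ]≔ true ∣ + 0                 ≡⟨ cong (λ c → ∣ B [ z ]≔ true ∣ + bit c) (∉⇒lookup z∉B) ⟨
          ∣ B [ z ]≔ true ∣ + bit (lookup B z)  ≡⟨ ∣update∣ B z true ⟩
          ∣ B ∣ + 1                             ∎
          where open ≡-Reasoning
      ha∉A : h a ∉ₛ A
      ha∉A ha∈A = a∉B (∈-update⁻ a≢z (∈-insertAt⁻ ha∈A))
      good : ∀ {v} → v ∉ₛ A × v ≢ y → Outside v × back v ∉ₛ B
      good {v} (v∉A , v≢y) = (v≢x , v≢y) , λ back∈B →
        v∉A (subst (_∈ₛ A) (h-back v≢y) (∈-insertAt⁺ ([]≔-minimal B _ z (back≢z v≢x v≢y) back∈B)))
        where
        v≢x : v ≢ x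
        v≢x refl = v∉A (subst (_∈ₛ A) h-z (∈-insertAt⁺ ([]≔-updates B z)))
      cutAtY : PathWithin D (_∉ₛ A) (h a) y → PathWithin D⁻ (_∉ₛ B) a z
      cutAtY (_ , walk , vs∉A) with firstVisit walk vs∉A (punchInᵢ≢i y a)
      ... | c , ws , ha⋯c , c→y , ws-ok =
        joinPaths (subst (λ s → PathWithin D⁻ (_∉ₛ B) s (back c)) (back-h a) (project good (ws , ha⋯c , ws-ok)))
                  (_ , step (arc-into-z (proj₁ c-good) c→y) (single z) , proj₂ c-good ∷ z∉B ∷ [])
        where
        c-good = good (allLast ha⋯c ws-ok)

    -- If z ∉ B, a walk of D - (B ∪ {y}) from x to h b, cut at its last
    -- visit of x, projects to a walk from z to b.
    fromZ : z ∉ₛ B → ∀ b → b ∉ₛ B → PathWithin D⁻ (_∉ₛ B) z b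
    fromZ z∉B b b∉B with b ≟ z
    ... | yes refl = _ , single z , b∉B ∷ []
    ... | no b≢z   = cutAtX (strongD A ∣A∣≤k x (h b) x∉A hb∉A)
      where
      A = insertAt B y true
      ∣A∣≤k : ∣ A ∣ ≤ k
      ∣A∣≤k = subst (_≤ k) (sym (∣insertAt∣ B y true)) ∣B∣+1≤k
      x∉A : x ∉ₛ A
      x∉A x∈A = z∉B (∈-insertAt⁻ (subst (_∈ₛ A) (sym h-z) x∈A))
      hb∉A : h b ∉ₛ A
      hb∉A hb∈A = b∉B (∈-insertAt⁻ hb∈A)
      good : ∀ {v} → v ∉ₛ A × v ≢ x → Outside v × back v ∉ₛ B
      good {v} (v∉A , v≢x) = (v≢x , v≢y) , λ back∈B → v∉A (subst (_∈ₛ A) (h-back v≢y) (∈-insertAt⁺ back∈B))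
        where
        v≢y : v ≢ y
        v≢y refl = v∉A (inserted∈ B y)
      x≢hb : x ≢ h b
      x≢hb x≡hb = b≢z (punchIn-injective y _ _ (trans (sym x≡hb) (sym h-z)))
      cutAtX : PathWithin D (_∉ₛ A) x (h b) → PathWithin D⁻ (_∉ₛ B) z b
      cutAtX (_ , walk , vs∉A) with lastVisit x walk vs∉A x≢hb (head∈ walk)
      ... | c , ws , x→c , c⋯hb , ws-ok =
        joinPaths (_ , step (arc-from-z (proj₁ c-good) x→c) (single (back c)) , z∉B ∷ proj₂ c-good ∷ [])
                  (subst (λ s → PathWithin D⁻ (_∉ₛ B) (back c) s) (back-h b) (project good (ws , c⋯hb , ws-ok)))
        where
        c-good = good (allHead c⋯hb ws-ok)

  strong⁻ : ∀ k → 1 ≤ k → (∀ A → ∣ A ∣ ≤ k → StronglyConnectedMinus D A) →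
    ∀ B → ∣ B ∣ ≤ k ∸ 1 → StronglyConnectedMinus D⁻ B
  strong⁻ k k≥1 strongD B ∣B∣<k = byCases (z ∈? B)
    where
    open Routes k strongD B (subst (∣ B ∣ + 1 ≤_) (m∸n+n≡m k≥1) (+-monoˡ-≤ 1 ∣B∣<k))
    byCases : Dec (z ∈ₛ B) → StronglyConnectedMinus D⁻ B
    byCases (yes z∈B)            = avoidingZ z∈B
    byCases (no z∉B) a b a∉B b∉B = joinPaths (toZ z∉B a a∉B) (fromZ z∉B b b∉B)

  kStrong⁻ : ∀ {k} → 1 ≤ k → KStrong D (k + 1) → KStrong D⁻ k
  kStrong⁻ {k} k≥1 (k+2≤n+1 , strongD) =
    ≤-pred (subst (_≤ suc n) (+-comm (k + 1) 1) k+2≤n+1) ,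
    strong⁻ k k≥1 (λ A ∣A∣≤k → strongD A (subst (∣ A ∣ ≤_) (sym (m+n∸n≡m k 1)) ∣A∣≤k))

  hamPath⁺ : ∀ o → o ≢ z → Hamiltonian D⁻ → HamPath D x y
  hamPath⁺ o o≢z ham with hamiltonianFrom ham z
  ... | _ , (_ , single _ , _ , cover) , _ with cover o
  ...   | here o≡z = ⊥-elim (o≢z o≡z)
  hamPath⁺ o o≢z ham
      | u , (_ ∷ ws , step z→c c⋯u , (z∉ws ∷ uniq) , cover) , u→z =
    subst (λ s → HamPath D s y) h-z (map h (z ∷ ws) ++ y ∷ [] , path⁺ , uniq⁺ , cover⁺)
    where
    ws≢z : All (_≢ z) ws
    ws≢z = All.map ≢-sym z∉ws
    path⁺ : Path D (h z) y (map h (z ∷ ws) ++ y ∷ [])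
    path⁺ = step (trans (sym (kept (allHead c⋯u ws≢z))) z→c)
      (appendPath (mapPath D⁻ D h (_≢ z) (λ _ b≢z a→b → trans (sym (kept b≢z)) a→b) c⋯u ws≢z)
                  (step (trans (sym (into-z (allLast c⋯u ws≢z))) u→z) (single y)))
    uniq⁺ : Unique (map h (z ∷ ws) ++ y ∷ [])
    uniq⁺ = Uniqueₚ.++⁺ (Uniqueₚ.map⁺ (punchIn-injective y _ _) (z∉ws ∷ uniq)) ([] ∷ []) y∉image
      where
      y∉image : ∀ {v} → v ∈ map h (z ∷ ws) × v ∈ y ∷ [] → ⊥
      y∉image (v∈image , here refl) with ∈-map⁻ h v∈image
      ... | b , _ , y≡hb = punchInᵢ≢i y b (sym y≡hb)
    cover⁺ : ∀ v → v ∈ map h (z ∷ ws) ++ y ∷ []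
    cover⁺ v with v ≟ y
    ... | yes refl = ∈-++⁺ʳ (map h (z ∷ ws)) (here refl)
    ... | no v≢y   = ∈-++⁺ˡ (subst (_∈ map h (z ∷ ws)) (h-back v≢y) (∈-map⁺ h (cover (back v))))

anotherVertex : ∀ {n} → 2 ≤ n → (w : Fin n) → ∃ λ o → o ≢ w
anotherVertex (s≤s (s≤s _)) zero    = suc zero , λ ()
anotherVertex (s≤s (s≤s _)) (suc w) = zero , λ ()

-- In a strong digraph every vertex w with some other vertex o has an
-- out-neighbour (first arc of a walk w ⋯ o) and an in-neighbour (last
-- arc of a walk o ⋯ w).
neighbours : ∀ {n} (G : Digraph n) → StronglyConnectedMinus G ∅ → ∀ {o w} → o ≢ w →
  1 ≤ outdeg G w × 1 ≤ indeg G w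
neighbours G strong {o} {w} o≢w = out≥1 (strong w o ∉∅ ∉∅) , in≥1 (strong o w ∉∅ ∉∅)
  where
  out≥1 : PathWithin G (_∉ₛ ∅) w o → 1 ≤ outdeg G w
  out≥1 (_ , single _ , _)   = ⊥-elim (o≢w refl)
  out≥1 (_ , step w→c _ , _) = count-pos (Digraph.adj G w) _ w→c
  in≥1 : PathWithin G (_∉ₛ ∅) o w → 1 ≤ indeg G w
  in≥1 (_ , o⋯w , _) with unsnoc o⋯w o≢w
  ... | c , _ , _ , c→w , _ = count-pos (λ v → Digraph.adj G v w) c c→w

-- Statement (b) for digraphs on m vertices; (b) itself is the case m = n + 1.
StatementBOn : ℕ → ℕ → ℕ → Set
StatementBOn k n m = ∀ (D : Digraph m) → KStrong D (k + 1) → (∀ x → n + 2 ≤ deg D x) →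
  StronglyHamiltonianConnected D

b⇒a : ∀ k n → 3 ≤ n → StatementB k n → StatementA k n
b⇒a k n n≥3 statementB D kStrong (S , ∣S∣≡n-1 , degS) with missesOne S (≤-trans (s≤s z≤n) n≥3) ∣S∣≡n-1
... | w , _ , others∈S with anotherVertex (≤-trans (s≤s (s≤s z≤n)) n≥3) w
...   | o , o≢w = hamiltonian⁻ o o≢w (statementB′ D⁺ (kStrong⁺ kStrong) minDegree (suc w) zero (λ ()))
  where
  open Split D w
  statementB′ : StatementBOn k n (suc n)
  statementB′ = subst (StatementBOn k n) (+-comm n 1) statementB
  w-neighbours = neighbours D (proj₂ kStrong ∅ (subst (_≤ k ∸ 1) (sym (∣∅∣≡0 n)) z≤n)) o≢w
  minDegree = minDegree⁺ (λ v v≢w → degS v (others∈S v v≢w)) (proj₁ w-neighbours) (proj₂ w-neighbours)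

a⇒b : ∀ k n → 2 ≤ k → 3 ≤ n → StatementA k n → StatementB k n
a⇒b k n k≥2 n≥3 statementA = subst (StatementBOn k n) (+-comm 1 n) statementB′
  where
  statementB′ : StatementBOn k n (suc n)
  statementB′ D kStrong deg≥n+2 x y x≢y with anotherVertex (≤-trans (s≤s (s≤s z≤n)) n≥3) (Contract.z D x y x≢y)
  ... | o , o≢z = hamPath⁺ o o≢z (statementA D⁻ (kStrong⁻ (≤-trans (s≤s z≤n) k≥2) kStrong) (S , ∣S∣≡n-1 , degS))
    where
    open Contract D x y x≢y
    S : Subset n
    S = ∁ ⁅ z ⁆
    ∣S∣≡n-1 : ∣ S ∣ ≡ n ∸ 1
    ∣S∣≡n-1 = trans (∣∁p∣≡n∸∣p∣ ⁅ z ⁆) (cong (n ∸_) (∣⁅x⁆∣≡1 z))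
    degS : ∀ v → v ∈ₛ S → n ≤ deg D⁻ v
    degS v v∈S = minDegree⁻ deg≥n+2 v (λ { refl → x∈∁p⇒x∉p v∈S (x∈⁅x⁆ z) })

theorem3p3 : ∀ (k n : ℕ) → 2 ≤ k → 3 ≤ n → (StatementA k n ⇔ StatementB k n)
theorem3p3 k n k≥2 n≥3 = mk⇔ (a⇒b k n k≥2 n≥3) (b⇒a k n n≥3)
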